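{- Let $n\ge 2$ and let $D_n=\langle a,b\mid a^n=e,\ b^2=e,\ bab^{ -1}=a^{ -1}\rangle$. Then the diameter of the intersection hypergraph $\tilde{\Gamma}_\mathcal{H}(D_n)$ equals $1$ if $n$ is prime, equals $3$ if $n=4k$ for some positive integer $k$, and equals $2$ otherwise.
   Context: For a group $G$, let $S$ be the set of all non-trivial proper subgroups of $G$. The intersection hypergraph $\tilde{\Gamma}_\mathcal{H}(G)$ has vertex set $V=\{H\in S \mid H\cap K=\{e\}\text{ for some }K\in S\}$, and a subset $E\subseteq V$ is a hyperedge iff any two distinct members of $E$ intersect trivially and $E$ is maximal among subsets of $V$ with this property. A path in a hypergraph is an alternating vertex–hyperedge sequence $v_0E_1v_1\cdots E_kv_k$ with $v_{i-1},v_i\in E_i$; its length is the number $k$ of hyperedges. The distance between two vertices is the minimum length of a path joining them, and the diameter is the maximum distance over all pairs of vertices. -}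

module Defs where

open import Data.Nat using (ℕ; zero; suc; _+_; _*_; _∸_; _%_; _≤_)
open import Data.Nat.DivMod using (m%n<n)
open import Data.Fin using (Fin; toℕ; fromℕ<)
open import Data.Fin.Subset using (Subset; _∈_; _∉_)
open import Data.Product using (Σ; ∃; _×_; _,_)
open import Relation.Binary.PropositionalEquality using (_≡_; _≢_)

-- Throughout, the index m stands for n = suc m (so Fin (suc m) = ℤ/nℤ).

addMod : ∀ {m} → Fin (suc m) → Fin (suc m) → Fin (suc m)
addMod {m} i j = fromℕ< (m%n<n (toℕ i + toℕ j) (suc m))

negMod : ∀ {m} → Fin (suc m) → Fin (suc m)
negMod {m} j = fromℕ< (m%n<n (suc m ∸ toℕ j) (suc m))

subMod : ∀ {m} → Fin (suc m) → Fin (suc m) → Fin (suc m)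
subMod i j = addMod i (negMod j)

-- Elements of the dihedral group D_n (n = suc m), of order 2n:
-- rot i = a^i and ref i = a^i b.
data Elem (m : ℕ) : Set where
  rot : Fin (suc m) → Elem m
  ref : Fin (suc m) → Elem m

e : ∀ {m} → Elem m
e = rot Fin.zero
  where import Data.Fin as Fin

-- Multiplication, using b a^j = a^{-j} b and b^2 = e.
_·_ : ∀ {m} → Elem m → Elem m → Elem m
rot i · rot j = rot (addMod i j)
rot i · ref j = ref (addMod i j)
ref i · rot j = ref (subMod i j)
ref i · ref j = rot (subMod i j)

inv : ∀ {m} → Elem m → Elem m
inv (rot i) = rot (negMod i)
inv (ref i) = ref i

record Sub (m : ℕ) : Set where
  constructor mkSub
  field
    rots : Subset (suc m)
    refs : Subset (suc m)

_∈D_ : ∀ {m} → Elem m → Sub m → Set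
rot i ∈D S = i ∈ Sub.rots S
ref i ∈D S = i ∈ Sub.refs S

IsSubgroup : ∀ {m} → Sub m → Set
IsSubgroup {m} H =
  (e ∈D H) × (∀ (x y : Elem m) → x ∈D H → y ∈D H → (x · y) ∈D H)
           × (∀ (x : Elem m) → x ∈D H → inv x ∈D H)

InS : ∀ {m} → Sub m → Set
InS {m} H = IsSubgroup H
          × (Σ (Elem m) λ x → x ∈D H × x ≢ e)
          × (Σ (Elem m) λ x → (x ∈D H → Data.Empty.⊥))
  where import Data.Empty

TrivInt : ∀ {m} → Sub m → Sub m → Set
TrivInt {m} H K = ∀ (x : Elem m) → x ∈D H → x ∈D K → x ≡ e

IsVertex : ∀ {m} → Sub m → Set
IsVertex {m} H = InS H × (Σ (Sub m) λ K → InS K × TrivInt H K)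

PairwiseTriv : ∀ {m} → (Sub m → Set) → Set
PairwiseTriv {m} E = (∀ H → E H → IsVertex H)
                   × (∀ (H K : Sub m) → E H → E K → H ≢ K → TrivInt H K)

IsHyperedge : ∀ {m} → (Sub m → Set) → Set₁
IsHyperedge {m} E = PairwiseTriv E
  × (∀ (F : Sub m → Set) → PairwiseTriv F → (∀ H → E H → F H) → ∀ H → F H → E H)

data Path {m : ℕ} : Sub m → Sub m → ℕ → Set₁ where
  nil  : ∀ {u} → Path u u 0
  cons : ∀ {u w v k} (E : Sub m → Set) → IsHyperedge E → E u → E w
       → Path w v k → Path u v (suc k)

Diameter : ℕ → ℕ → Set₁
Diameter m d =
  (∀ (u v : Sub m) → IsVertex u → IsVertex v → Σ ℕ λ k → k ≤ d × Path u v k)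
  × (Σ (Sub m) λ u → Σ (Sub m) λ v → IsVertex u × IsVertex v
       × (∀ k → Path u v k → d ≤ k))

-- Every nontrivial proper subgroup of D_n misses some reflection a^j b and so meets
-- {e, a^j b} trivially; the chain u — {e, a^j b} — {e, a^k b} — v bounds the diameter by 3.
-- Hyperedges are the maximal cliques of the graph "intersects trivially" on the vertex set,
-- so the hypergraph distance is the distance in that graph.
-- For n prime a nontrivial proper subgroup is determined by any of its nontrivial elements,
-- so distinct vertices intersect trivially.
-- If 4 ∤ n, two vertices u, v either miss a common reflection, or between them they contain
-- every reflection; the latter forces a ∉ u and a² ∈ u (and likewise for v), which is
-- impossible for odd n and, for n = 2h with h odd, leaves the half-turn a^h outside u and v.
-- For a proper divisor d of n the subgroups ⟨a^d, b⟩ and ⟨a^d, ab⟩ share a^d; for d = 2 and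
-- 4 ∣ n no vertex meets both trivially: a reflection lies in one of them, and a rotation
-- r ≠ e would give r² ∈ ⟨a²⟩, hence r² = e and r = a^{n/2} ∈ ⟨a², b⟩.
module Submission where

open import Defs
open import Level using (0ℓ)
open import Algebra.Bundles using (AbelianGroup)
import Algebra.Properties.AbelianGroup
import Algebra.Properties.CommutativeSemigroup
open import Data.Bool.Properties using () renaming (_≟_ to _≟ᵇ_)
open import Data.Empty using (⊥-elim)
open import Data.Fin using (Fin; zero; suc; toℕ)
open import Data.Fin.Properties using (toℕ-injective; toℕ-fromℕ<; toℕ<n; any?; all?) renaming (_≟_ to _≟ᶠ_)
open import Data.Fin.Subset using (Subset; inside; outside; ⁅_⁆; _∪_; ⊥) renaming (_∈_ to _∈ₛ_)
open import Data.Fin.Subset.Properties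
  using (x∈⁅x⁆; x∈⁅y⁆⇒x≡y; x∈p∪q⁺; x∈p∪q⁻; ∉⊥; ⊆-antisym; _∈?_; anySubset?)
open import Data.List using (List; []; _∷_; map; _++_; cartesianProductWith)
open import Data.List.Membership.Propositional using () renaming (_∈_ to _∈ₗ_)
open import Data.List.Membership.Propositional.Properties
  using (∈-map⁺; ∈-++⁺ˡ; ∈-++⁺ʳ; ∈-cartesianProductWith⁺)
open import Data.List.Relation.Unary.All as All using (All; []; _∷_)
open import Data.List.Relation.Unary.Any using (here; there)
open import Data.Nat using (ℕ; zero; suc; _+_; _*_; _∸_; _%_; _≤_; _<_; z≤n; s≤s; NonZero; nonTrivial⇒n>1)
open import Data.Nat.Coprimality using (coprime-Bézout; prime⇒coprime)
open import Data.Nat.Divisibility using (_∣_; divides; m%n≡0⇒n∣m)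
open import Data.Nat.DivMod
  using (_mod_; %-distribˡ-+; m%n%n≡m%n; n%n≡0; m<n⇒m%n≡m; [m+kn]%n≡m%n; m*n%n≡0; m∣n⇒o%n%m≡o%m)
open import Data.Nat.GCD using (module Bézout)
open import Data.Nat.Primality using (Prime; Composite; composite; ¬prime⇒composite)
open import Data.Nat.Properties
  using ( +-comm; +-assoc; +-identityʳ; *-identityʳ; *-comm; *-assoc; *-distribˡ-+; *-cancelˡ-≡
        ; m∸n+n≡m; <⇒≤; ≤-refl; suc-injective; m+n≡0⇒m≡0; m≤m+n; m<m*n
        ; +-mono-<; +-mono-≤; <-≤-trans; <-irrefl)
open import Data.Product using (Σ; ∃; _×_; _,_; proj₁; proj₂)
open import Data.Sum using (_⊎_; inj₁; inj₂; [_,_]′)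
open import Data.Vec using ([]; _∷_; tabulate; lookup)
open import Data.Vec.Properties using (≡-dec; lookup∘tabulate; lookup⇒[]=; []=⇒lookup)
open import Function using (id; _∘_)
open import Relation.Binary using (DecidableEquality; Symmetric) renaming (Decidable to Decidable₂)
open import Relation.Binary.PropositionalEquality
  using (_≡_; _≢_; refl; sym; trans; cong; cong₂; subst; isEquivalence; module ≡-Reasoning)
open import Relation.Nullary
  using (¬_; Dec; yes; no; ¬?; map′; _×-dec_; _⊎-dec_; _→-dec_; decidable-stable)
open import Relation.Unary using (Decidable)

open ≡-Reasoning

[m%d+n]%d≡[m+n]%d : ∀ m n d .{{_ : NonZero d}} → (m % d + n) % d ≡ (m + n) % d
[m%d+n]%d≡[m+n]%d m n d = begin
  (m % d + n) % d         ≡⟨ %-distribˡ-+ (m % d) n d ⟩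
  (m % d % d + n % d) % d ≡⟨ cong (λ x → (x + n % d) % d) (m%n%n≡m%n m d) ⟩
  (m % d + n % d) % d     ≡⟨ %-distribˡ-+ m n d ⟨
  (m + n) % d             ∎

toℕ-mod : ∀ a n .{{_ : NonZero n}} → toℕ (a mod n) ≡ a % n
toℕ-mod a n = toℕ-fromℕ< _

mod-cong : ∀ {a b} n .{{_ : NonZero n}} → a % n ≡ b % n → a mod n ≡ b mod n
mod-cong {a} {b} n eq = toℕ-injective (trans (toℕ-mod a n) (trans eq (sym (toℕ-mod b n))))

mod≡zero : ∀ a {k} → a % suc k ≡ 0 → a mod suc k ≡ zero
mod≡zero a = mod-cong {a} {0} _

mod-toℕ : ∀ {n} .{{_ : NonZero n}} (i : Fin n) → toℕ i mod n ≡ i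
mod-toℕ i = toℕ-injective (trans (toℕ-mod _ _) (m<n⇒m%n≡m (toℕ<n i)))

mod-absorbˡ : ∀ a b n .{{_ : NonZero n}} → (toℕ (a mod n) + b) mod n ≡ (a + b) mod n
mod-absorbˡ a b n = mod-cong n (trans (cong (λ x → (x + b) % n) (toℕ-mod a n)) ([m%d+n]%d≡[m+n]%d a b n))

mod-absorbʳ : ∀ a b n .{{_ : NonZero n}} → (a + toℕ (b mod n)) mod n ≡ (a + b) mod n
mod-absorbʳ a b n = begin
  (a + toℕ (b mod n)) mod n ≡⟨ cong (_mod n) (+-comm a _) ⟩
  (toℕ (b mod n) + a) mod n ≡⟨ mod-absorbˡ b a n ⟩
  (b + a) mod n             ≡⟨ cong (_mod n) (+-comm b a) ⟩
  (a + b) mod n             ∎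

module _ {m : ℕ} where
  private
    n = suc m

  addMod-assoc : ∀ (i j k : Fin n) → addMod (addMod i j) k ≡ addMod i (addMod j k)
  addMod-assoc i j k = begin
    (toℕ ((toℕ i + toℕ j) mod n) + toℕ k) mod n ≡⟨ mod-absorbˡ (toℕ i + toℕ j) (toℕ k) n ⟩
    (toℕ i + toℕ j + toℕ k) mod n               ≡⟨ cong (_mod n) (+-assoc (toℕ i) (toℕ j) (toℕ k)) ⟩
    (toℕ i + (toℕ j + toℕ k)) mod n             ≡⟨ mod-absorbʳ (toℕ i) (toℕ j + toℕ k) n ⟨
    (toℕ i + toℕ ((toℕ j + toℕ k) mod n)) mod n ∎

  addMod-comm : ∀ (i j : Fin n) → addMod i j ≡ addMod j i
  addMod-comm i j = cong (_mod n) (+-comm (toℕ i) (toℕ j))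

  addMod-identityˡ : ∀ (i : Fin n) → addMod zero i ≡ i
  addMod-identityˡ = mod-toℕ

  addMod-identityʳ : ∀ (i : Fin n) → addMod i zero ≡ i
  addMod-identityʳ i = trans (cong (_mod n) (+-identityʳ (toℕ i))) (mod-toℕ i)

  negMod-inverseˡ : ∀ (i : Fin n) → addMod (negMod i) i ≡ zero
  negMod-inverseˡ i = begin
    (toℕ ((n ∸ toℕ i) mod n) + toℕ i) mod n ≡⟨ mod-absorbˡ (n ∸ toℕ i) (toℕ i) n ⟩
    (n ∸ toℕ i + toℕ i) mod n               ≡⟨ cong (_mod n) (m∸n+n≡m (<⇒≤ (toℕ<n i))) ⟩
    n mod n                                 ≡⟨ mod≡zero n (n%n≡0 n) ⟩
    zero                                    ∎

  negMod-inverseʳ : ∀ (i : Fin n) → addMod i (negMod i) ≡ zero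
  negMod-inverseʳ i = trans (addMod-comm i (negMod i)) (negMod-inverseˡ i)

cyclicGroup : ℕ → AbelianGroup 0ℓ 0ℓ
cyclicGroup m = record
  { Carrier = Fin (suc m) ; _≈_ = _≡_ ; _∙_ = addMod ; ε = zero ; _⁻¹ = negMod
  ; isAbelianGroup = record
    { isGroup = record
      { isMonoid = record
        { isSemigroup = record
          { isMagma = record { isEquivalence = isEquivalence ; ∙-cong = cong₂ addMod }
          ; assoc = addMod-assoc }
        ; identity = addMod-identityˡ , addMod-identityʳ }
      ; inverse = negMod-inverseˡ , negMod-inverseʳ
      ; ⁻¹-cong = cong negMod }
    ; comm = addMod-comm } }

module ℤ/ {m : ℕ} = AbelianGroup (cyclicGroup m)
module ℤ/-Properties {m : ℕ} = Algebra.Properties.AbelianGroup (cyclicGroup m)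
module ℤ/-CommutativeSemigroup {m : ℕ} = Algebra.Properties.CommutativeSemigroup (ℤ/.commutativeSemigroup {m})

open ℤ/ using (_∙_; ε; _⁻¹; _-_; identityˡ; identityʳ; inverseˡ; inverseʳ)
open ℤ/-Properties
  using (inverseˡ-unique; ε⁻¹≈ε; ⁻¹-involutive; ⁻¹-∙-comm; x∙y⁻¹≈ε⇒x≈y; //-rightDividesˡ; //-rightDividesʳ)
open ℤ/-CommutativeSemigroup using (interchange)

mod-+-homo : ∀ {m} a b → (a + b) mod suc m ≡ (a mod suc m) ∙ (b mod suc m)
mod-+-homo {m} a b = sym (trans (mod-absorbˡ a _ (suc m)) (mod-absorbʳ a b (suc m)))

[x∙z]-[y∙z]≡x-y : ∀ {m} (x y z : Fin (suc m)) → (x ∙ z) - (y ∙ z) ≡ x - y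
[x∙z]-[y∙z]≡x-y x y z = begin
  (x ∙ z) ∙ (y ∙ z) ⁻¹    ≡⟨ cong ((x ∙ z) ∙_) (⁻¹-∙-comm y z) ⟨
  (x ∙ z) ∙ (y ⁻¹ ∙ z ⁻¹) ≡⟨ interchange x z (y ⁻¹) (z ⁻¹) ⟩
  (x - y) ∙ (z ∙ z ⁻¹)    ≡⟨ cong ((x - y) ∙_) (inverseʳ z) ⟩
  (x - y) ∙ ε             ≡⟨ identityʳ (x - y) ⟩
  x - y                   ∎

involution-index : ∀ {m} {i : Fin (suc m)} → i ∙ i ≡ ε → i ≢ ε → toℕ i + toℕ i ≡ suc m
involution-index {m} {i} ii≡ε i≢ε with m%n≡0⇒n∣m (toℕ i + toℕ i) (suc m) 2i%n≡0
  where 2i%n≡0 = trans (sym (toℕ-mod (toℕ i + toℕ i) (suc m))) (cong toℕ ii≡ε)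
... | divides zero 2i≡0 = ⊥-elim (i≢ε (toℕ-injective (m+n≡0⇒m≡0 (toℕ i) 2i≡0)))
... | divides 1 2i≡n = trans 2i≡n (+-identityʳ (suc m))
... | divides (suc (suc c)) 2i≡[2+c]n = ⊥-elim (<-irrefl 2i≡[2+c]n 2i<[2+c]n)
  where
    2i<[2+c]n : toℕ i + toℕ i < suc (suc c) * suc m
    2i<[2+c]n = <-≤-trans (+-mono-< (toℕ<n i) (toℕ<n i)) (+-mono-≤ {suc m} ≤-refl (m≤m+n (suc m) _))

ℤ/2-double : (y : Fin 2) → y ∙ y ≡ ε
ℤ/2-double zero = refl
ℤ/2-double (suc zero) = refl

data Parity (a : ℕ) : Set where
  even : ∀ k → a ≡ k * 2 → Parity a
  odd  : ∀ k → a ≡ 1 + k * 2 → Parity a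

parity : ∀ a → Parity a
parity zero = even 0 refl
parity (suc a) with parity a
... | even k refl = odd k refl
... | odd k refl = even (suc k) refl

-- A greedy pass over an enumeration of the (finite) type, started from an adjacent pair,
-- produces a maximal clique through that pair.
module MaximalCliques {A : Set} (_≟_ : DecidableEquality A)
  {V : A → Set} (V? : Decidable V) {T : A → A → Set} (T? : Decidable₂ T) (T-sym : Symmetric T)
  (enum : List A) (enum-complete : ∀ x → x ∈ₗ enum) where

  Adjacent : A → A → Set
  Adjacent x y = x ≡ y ⊎ T x y

  IsClique : (A → Set) → Set
  IsClique P = (∀ x → P x → V x) × (∀ x y → P x → P y → x ≢ y → T x y)

  IsMaximalClique : (A → Set) → Set₁
  IsMaximalClique P = IsClique P × (∀ Q → IsClique Q → (∀ x → P x → Q x) → ∀ x → Q x → P x)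

  adjacent-sym : ∀ {x y} → Adjacent x y → Adjacent y x
  adjacent-sym (inj₁ refl) = inj₁ refl
  adjacent-sym (inj₂ t) = inj₂ (T-sym t)

  clique-adjacent : ∀ {P} → IsClique P → ∀ {x y} → P x → P y → Adjacent x y
  clique-adjacent (_ , pairwise) {x} {y} x∈ y∈ with x ≟ y
  ... | yes x≡y = inj₁ x≡y
  ... | no x≢y = inj₂ (pairwise x y x∈ y∈ x≢y)

  IsCliqueList : List A → Set
  IsCliqueList xs = All V xs × (∀ {x y} → x ∈ₗ xs → y ∈ₗ xs → Adjacent x y)

  Extends : List A → A → Set
  Extends xs x = V x × All (Adjacent x) xs

  extends? : ∀ xs x → Dec (Extends xs x)
  extends? xs x = V? x ×-dec All.all? (λ y → (x ≟ y) ⊎-dec T? x y) xs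

  greedy : List A → List A → List A
  greedy acc [] = acc
  greedy acc (x ∷ xs) with extends? acc x
  ... | yes _ = greedy (x ∷ acc) xs
  ... | no _ = greedy acc xs

  greedy-⊇ : ∀ {acc} xs {y} → y ∈ₗ acc → y ∈ₗ greedy acc xs
  greedy-⊇ [] y∈ = y∈
  greedy-⊇ {acc} (x ∷ xs) y∈ with extends? acc x
  ... | yes _ = greedy-⊇ xs (there y∈)
  ... | no _ = greedy-⊇ xs y∈

  greedy-clique : ∀ {acc} xs → IsCliqueList acc → IsCliqueList (greedy acc xs)
  greedy-clique [] c = c
  greedy-clique {acc} (x ∷ xs) c with extends? acc x
  ... | no _ = greedy-clique xs c
  ... | yes (Vx , x~acc) = greedy-clique xs (Vx ∷ proj₁ c , pairs)
    where
      pairs : ∀ {y z} → y ∈ₗ x ∷ acc → z ∈ₗ x ∷ acc → Adjacent y z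
      pairs (here refl) (here refl) = inj₁ refl
      pairs (here refl) (there z∈) = All.lookup x~acc z∈
      pairs (there y∈) (here refl) = adjacent-sym (All.lookup x~acc y∈)
      pairs (there y∈) (there z∈) = proj₂ c y∈ z∈

  greedy-maximal : ∀ {Q} → IsClique Q → ∀ {acc} xs → (∀ y → y ∈ₗ greedy acc xs → Q y)
                 → ∀ {x} → x ∈ₗ xs → Q x → x ∈ₗ greedy acc xs
  greedy-maximal Q-clique {acc} (x ∷ xs) ⊆Q x∈ Qx with extends? acc x
  greedy-maximal Q-clique (x ∷ xs) ⊆Q (here refl) Qx | yes _ = greedy-⊇ xs (here refl)
  greedy-maximal Q-clique (x ∷ xs) ⊆Q (there x∈) Qx | yes _ = greedy-maximal Q-clique xs ⊆Q x∈ Qx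
  greedy-maximal Q-clique (x ∷ xs) ⊆Q (there x∈) Qx | no _ = greedy-maximal Q-clique xs ⊆Q x∈ Qx
  greedy-maximal Q-clique (x ∷ xs) ⊆Q (here refl) Qx | no ¬extends = ⊥-elim (¬extends
    (proj₁ Q-clique x Qx , All.tabulate λ y∈ → clique-adjacent Q-clique Qx (⊆Q _ (greedy-⊇ xs y∈))))

  maximalClique : ∀ {u w} → V u → V w → Adjacent u w → Σ (A → Set) λ P → IsMaximalClique P × P u × P w
  maximalClique {u} {w} Vu Vw u~w =
    P , (P-clique , P-maximal) , greedy-⊇ enum (here refl) , greedy-⊇ enum (there (here refl))
    where
      P : A → Set
      P x = x ∈ₗ greedy (u ∷ w ∷ []) enum
      start : IsCliqueList (u ∷ w ∷ [])
      start = Vu ∷ Vw ∷ [] , pairs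
        where
          pairs : ∀ {x y} → x ∈ₗ u ∷ w ∷ [] → y ∈ₗ u ∷ w ∷ [] → Adjacent x y
          pairs (here refl) (here refl) = inj₁ refl
          pairs (here refl) (there (here refl)) = u~w
          pairs (there (here refl)) (here refl) = adjacent-sym u~w
          pairs (there (here refl)) (there (here refl)) = inj₁ refl
      adjacent⇒T : ∀ {x y} → Adjacent x y → x ≢ y → T x y
      adjacent⇒T (inj₁ x≡y) x≢y = ⊥-elim (x≢y x≡y)
      adjacent⇒T (inj₂ t) _ = t
      P-clique : IsClique P
      P-clique = (λ x x∈ → All.lookup (proj₁ final) x∈) , λ x y x∈ y∈ → adjacent⇒T (proj₂ final x∈ y∈)
        where final = greedy-clique enum start
      P-maximal : ∀ Q → IsClique Q → (∀ x → P x → Q x) → ∀ x → Q x → P x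
      P-maximal Q Q-clique P⊆Q x Qx = greedy-maximal Q-clique enum P⊆Q (enum-complete x) Qx

subsets : ∀ k → List (Subset k)
subsets zero = [] ∷ []
subsets (suc k) = map (inside ∷_) (subsets k) ++ map (outside ∷_) (subsets k)

∈-subsets : ∀ {k} (p : Subset k) → p ∈ₗ subsets k
∈-subsets [] = here refl
∈-subsets {suc k} (inside ∷ p) = ∈-++⁺ˡ (∈-map⁺ (inside ∷_) (∈-subsets p))
∈-subsets {suc k} (outside ∷ p) = ∈-++⁺ʳ (map (inside ∷_) (subsets k)) (∈-map⁺ (outside ∷_) (∈-subsets p))

preimageₛ : ∀ {a b} → (Fin a → Fin b) → Subset b → Subset a
preimageₛ f p = tabulate (lookup p ∘ f)

∈-preimageₛ⁺ : ∀ {a b} {f : Fin a → Fin b} {p i} → f i ∈ₛ p → i ∈ₛ preimageₛ f p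
∈-preimageₛ⁺ {f = f} {p} {i} fi∈ = lookup⇒[]= i _ (trans (lookup∘tabulate (lookup p ∘ f) i) ([]=⇒lookup fi∈))

∈-preimageₛ⁻ : ∀ {a b} {f : Fin a → Fin b} {p i} → i ∈ₛ preimageₛ f p → f i ∈ₛ p
∈-preimageₛ⁻ {f = f} {p} {i} i∈ =
  lookup⇒[]= (f i) p (trans (sym (lookup∘tabulate (lookup p ∘ f) i)) ([]=⇒lookup i∈))

module _ {m : ℕ} where

  rot-injective : ∀ {i j : Fin (suc m)} → rot {m} i ≡ rot j → i ≡ j
  rot-injective refl = refl

  ·-identityˡ : (x : Elem m) → e · x ≡ x
  ·-identityˡ (rot i) = cong rot (identityˡ i)
  ·-identityˡ (ref i) = cong ref (identityˡ i)

  ·-identityʳ : (x : Elem m) → x · e ≡ x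
  ·-identityʳ (rot i) = cong rot (identityʳ i)
  ·-identityʳ (ref i) = cong ref (trans (cong (i ∙_) ε⁻¹≈ε) (identityʳ i))

  ref-involution : (j : Fin (suc m)) → ref j · ref j ≡ e
  ref-involution j = cong rot (inverseʳ j)

  inv-involution : {g : Elem m} → g · g ≡ e → inv g ≡ g
  inv-involution {rot h} gg = cong rot (sym (inverseˡ-unique h h (rot-injective gg)))
  inv-involution {ref j} gg = refl

  Sub-ext : {H K : Sub m} → (∀ x → x ∈D H → x ∈D K) → (∀ x → x ∈D K → x ∈D H) → H ≡ K
  Sub-ext {mkSub r f} {mkSub r′ f′} H⊆K K⊆H =
    cong₂ mkSub (⊆-antisym (H⊆K (rot _)) (K⊆H (rot _))) (⊆-antisym (H⊆K (ref _)) (K⊆H (ref _)))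

  TrivInt-sym : {H K : Sub m} → TrivInt H K → TrivInt K H
  TrivInt-sym trivial x x∈K x∈H = trivial x x∈H x∈K

  _∈D?_ : (x : Elem m) (H : Sub m) → Dec (x ∈D H)
  rot i ∈D? H = i ∈? Sub.rots H
  ref i ∈D? H = i ∈? Sub.refs H

  module _ {H : Sub m} (H≤ : IsSubgroup H) where

    e∈ : rot ε ∈D H
    e∈ = proj₁ H≤

    rot-closed : ∀ {i j} → rot i ∈D H → rot j ∈D H → rot (i ∙ j) ∈D H
    rot-closed = proj₁ (proj₂ H≤) (rot _) (rot _)

    rot⁻¹-closed : ∀ {i} → rot i ∈D H → rot (i ⁻¹) ∈D H
    rot⁻¹-closed = proj₂ (proj₂ H≤) (rot _)

    rot-ref-closed : ∀ {i j} → rot i ∈D H → ref j ∈D H → ref (i ∙ j) ∈D H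
    rot-ref-closed = proj₁ (proj₂ H≤) (rot _) (ref _)

    ref-ref-closed : ∀ {i j} → ref i ∈D H → ref j ∈D H → rot (i - j) ∈D H
    ref-ref-closed = proj₁ (proj₂ H≤) (ref _) (ref _)

    rot-multiple-closed : ∀ a → rot (a mod suc m) ∈D H → ∀ k → rot ((k * a) mod suc m) ∈D H
    rot-multiple-closed a a∈ zero = e∈
    rot-multiple-closed a a∈ (suc k) =
      subst (λ t → rot t ∈D H) (sym (mod-+-homo a (k * a))) (rot-closed a∈ (rot-multiple-closed a a∈ k))

    reflections⇒everything : (∀ j → ref j ∈D H) → ∀ x → x ∈D H
    reflections⇒everything refs (rot t) =
      subst (λ i → rot i ∈D H) (//-rightDividesʳ ε t) (ref-ref-closed (refs (t ∙ ε)) (refs ε))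
    reflections⇒everything refs (ref j) = refs j

    rotations⇒everything : (∀ t → rot t ∈D H) → ∀ {p} → ref p ∈D H → ∀ x → x ∈D H
    rotations⇒everything rots p∈ (rot t) = rots t
    rotations⇒everything rots {p} p∈ (ref j) =
      subst (λ q → ref q ∈D H) (//-rightDividesˡ p j) (rot-ref-closed (rots (j - p)) p∈)

  misses-reflection : {H : Sub m} → InS H → ∃ λ j → ¬ ref j ∈D H
  misses-reflection {H} (H≤ , _ , x , x∉) with any? (λ j → ¬? (ref j ∈D? H))
  ... | yes found = found
  ... | no none = ⊥-elim (x∉ (reflections⇒everything H≤ all-refs x))
    where
      all-refs : ∀ j → ref j ∈D H
      all-refs j = decidable-stable (ref j ∈D? H) (λ j∉ → none (j , j∉))

  ⁅e,_⁆ : Elem m → Sub m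
  ⁅e, rot h ⁆ = mkSub (⁅ ε ⁆ ∪ ⁅ h ⁆) ⊥
  ⁅e, ref j ⁆ = mkSub ⁅ ε ⁆ ⁅ j ⁆

  ∈⁅e,g⁆⁻ : ∀ {g} x → x ∈D ⁅e, g ⁆ → x ≡ e ⊎ x ≡ g
  ∈⁅e,g⁆⁻ {rot h} (rot i) i∈ with x∈p∪q⁻ ⁅ ε ⁆ ⁅ h ⁆ i∈
  ... | inj₁ i∈ε = inj₁ (cong rot (x∈⁅y⁆⇒x≡y ε i∈ε))
  ... | inj₂ i∈h = inj₂ (cong rot (x∈⁅y⁆⇒x≡y h i∈h))
  ∈⁅e,g⁆⁻ {rot h} (ref i) i∈ = ⊥-elim (∉⊥ i∈)
  ∈⁅e,g⁆⁻ {ref j} (rot i) i∈ = inj₁ (cong rot (x∈⁅y⁆⇒x≡y ε i∈))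
  ∈⁅e,g⁆⁻ {ref j} (ref i) i∈ = inj₂ (cong ref (x∈⁅y⁆⇒x≡y j i∈))

  ∈⁅e,g⁆⁺ : ∀ g {x} → x ≡ e ⊎ x ≡ g → x ∈D ⁅e, g ⁆
  ∈⁅e,g⁆⁺ (rot h) (inj₁ refl) = x∈p∪q⁺ (inj₁ (x∈⁅x⁆ ε))
  ∈⁅e,g⁆⁺ (ref j) (inj₁ refl) = x∈⁅x⁆ ε
  ∈⁅e,g⁆⁺ (rot h) (inj₂ refl) = x∈p∪q⁺ {p = ⁅ ε ⁆} (inj₂ (x∈⁅x⁆ h))
  ∈⁅e,g⁆⁺ (ref j) (inj₂ refl) = x∈⁅x⁆ j

  ref∉⁅e,ref⁆ : ∀ {i j} → i ≢ j → ¬ ref i ∈D ⁅e, ref j ⁆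
  ref∉⁅e,ref⁆ {i} {j} i≢j i∈ = [ (λ ()) , (λ { refl → i≢j refl }) ]′ (∈⁅e,g⁆⁻ {ref j} (ref i) i∈)

  ⁅e,g⁆-isSubgroup : ∀ g → g · g ≡ e → IsSubgroup ⁅e, g ⁆
  ⁅e,g⁆-isSubgroup g gg =
      ∈⁅e,g⁆⁺ g (inj₁ refl)
    , (λ x y x∈ y∈ → ∈⁅e,g⁆⁺ g (·-closed (∈⁅e,g⁆⁻ x x∈) (∈⁅e,g⁆⁻ y y∈)))
    , (λ x x∈ → ∈⁅e,g⁆⁺ g (inv-closed (∈⁅e,g⁆⁻ x x∈)))
    where
      ·-closed : ∀ {x y} → x ≡ e ⊎ x ≡ g → y ≡ e ⊎ y ≡ g → x · y ≡ e ⊎ x · y ≡ g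
      ·-closed {y = y} (inj₁ refl) y∈ = subst (λ z → z ≡ e ⊎ z ≡ g) (sym (·-identityˡ y)) y∈
      ·-closed {x = x} x∈ (inj₁ refl) = subst (λ z → z ≡ e ⊎ z ≡ g) (sym (·-identityʳ x)) x∈
      ·-closed (inj₂ refl) (inj₂ refl) = inj₁ gg
      inv-closed : ∀ {x} → x ≡ e ⊎ x ≡ g → inv x ≡ e ⊎ inv x ≡ g
      inv-closed (inj₁ refl) = inj₁ (cong rot ε⁻¹≈ε)
      inv-closed (inj₂ refl) = inj₂ (inv-involution gg)

  ⁅e,g⁆-InS : ∀ g x → g · g ≡ e → g ≢ e → x ≢ e → x ≢ g → InS ⁅e, g ⁆
  ⁅e,g⁆-InS g x gg g≢e x≢e x≢g =
    ⁅e,g⁆-isSubgroup g gg , (g , ∈⁅e,g⁆⁺ g (inj₂ refl) , g≢e) , (x , λ x∈ → [ x≢e , x≢g ]′ (∈⁅e,g⁆⁻ x x∈))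

  ⁅e,g⁆-trivInt : ∀ g {H : Sub m} → ¬ g ∈D H → TrivInt H ⁅e, g ⁆
  ⁅e,g⁆-trivInt g g∉ x x∈H x∈ with ∈⁅e,g⁆⁻ x x∈
  ... | inj₁ x≡e = x≡e
  ... | inj₂ refl = ⊥-elim (g∉ x∈H)

  ⁅e,ref⁆-InS : ∀ {H : Sub m} {j} → InS H → ¬ ref j ∈D H → InS ⁅e, ref j ⁆
  ⁅e,ref⁆-InS {j = j} (_ , (x , x∈ , x≢e) , _) j∉ =
    ⁅e,g⁆-InS (ref j) x (ref-involution j) (λ ()) x≢e (λ { refl → j∉ x∈ })

  InS⇒IsVertex : {H : Sub m} → InS H → IsVertex H
  InS⇒IsVertex H∈S with misses-reflection H∈S
  ... | j , j∉ = H∈S , ⁅e, ref j ⁆ , ⁅e,ref⁆-InS H∈S j∉ , ⁅e,g⁆-trivInt (ref j) j∉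

  subs : List (Sub m)
  subs = cartesianProductWith mkSub (subsets (suc m)) (subsets (suc m))

  ∈-subs : (H : Sub m) → H ∈ₗ subs
  ∈-subs (mkSub r f) = ∈-cartesianProductWith⁺ mkSub (∈-subsets r) (∈-subsets f)

  _≟Sub_ : DecidableEquality (Sub m)
  mkSub r f ≟Sub mkSub r′ f′ =
    map′ (λ { (refl , refl) → refl }) (λ { refl → refl , refl }) (≡-dec _≟ᵇ_ r r′ ×-dec ≡-dec _≟ᵇ_ f f′)

  _≟Elem_ : DecidableEquality (Elem m)
  rot i ≟Elem rot j = map′ (cong rot) rot-injective (i ≟ᶠ j)
  rot i ≟Elem ref j = no λ ()
  ref i ≟Elem rot j = no λ ()
  ref i ≟Elem ref j = map′ (cong ref) (λ { refl → refl }) (i ≟ᶠ j)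

  all-Elem? : {P : Elem m → Set} → (∀ x → Dec (P x)) → Dec (∀ x → P x)
  all-Elem? P? = map′ (λ { (rots , refs) (rot i) → rots i ; (rots , refs) (ref i) → refs i })
                      (λ all → all ∘ rot , all ∘ ref) (all? (P? ∘ rot) ×-dec all? (P? ∘ ref))

  any-Elem? : {P : Elem m → Set} → (∀ x → Dec (P x)) → Dec (∃ P)
  any-Elem? P? = map′ (λ { (inj₁ (i , p)) → rot i , p ; (inj₂ (i , p)) → ref i , p })
                      (λ { (rot i , p) → inj₁ (i , p) ; (ref i , p) → inj₂ (i , p) })
                      (any? (P? ∘ rot) ⊎-dec any? (P? ∘ ref))

  any-Sub? : {P : Sub m → Set} → (∀ H → Dec (P H)) → Dec (∃ P)
  any-Sub? P? = map′ (λ { (r , f , p) → mkSub r f , p }) (λ { (mkSub r f , p) → r , f , p })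
                     (anySubset? λ r → anySubset? λ f → P? (mkSub r f))

  IsSubgroup? : (H : Sub m) → Dec (IsSubgroup H)
  IsSubgroup? H = (e ∈D? H)
    ×-dec all-Elem? (λ x → all-Elem? λ y → (x ∈D? H) →-dec ((y ∈D? H) →-dec ((x · y) ∈D? H)))
    ×-dec all-Elem? (λ x → (x ∈D? H) →-dec (inv x ∈D? H))

  InS? : (H : Sub m) → Dec (InS H)
  InS? H = IsSubgroup? H
    ×-dec any-Elem? (λ x → (x ∈D? H) ×-dec ¬? (x ≟Elem e))
    ×-dec any-Elem? (λ x → ¬? (x ∈D? H))

  TrivInt? : (H K : Sub m) → Dec (TrivInt H K)
  TrivInt? H K = all-Elem? λ x → (x ∈D? H) →-dec ((x ∈D? K) →-dec (x ≟Elem e))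

  IsVertex? : (H : Sub m) → Dec (IsVertex H)
  IsVertex? H = InS? H ×-dec any-Sub? (λ K → InS? K ×-dec TrivInt? H K)

-- Paths in the intersection hypergraph

  -- With V = IsVertex and T = TrivInt, IsMaximalClique is IsHyperedge by definition.
  open MaximalCliques _≟Sub_ IsVertex? TrivInt? TrivInt-sym subs ∈-subs public
    using (Adjacent; maximalClique; clique-adjacent)

  step : ∀ {u w v : Sub m} {k} → InS u → InS w → Adjacent u w → Path w v k → Path u v (suc k)
  step u∈S w∈S u~w p =
    let E , E-hyperedge , u∈ , w∈ = maximalClique (InS⇒IsVertex u∈S) (InS⇒IsVertex w∈S) u~w
    in cons E E-hyperedge u∈ w∈ p

  path-via : ∀ {u v : Sub m} g → InS u → InS v → InS ⁅e, g ⁆ → ¬ g ∈D u → ¬ g ∈D v → Path u v 2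
  path-via g u∈S v∈S g∈S g∉u g∉v =
    step u∈S g∈S (inj₂ (⁅e,g⁆-trivInt g g∉u)) (step g∈S v∈S (inj₂ (TrivInt-sym (⁅e,g⁆-trivInt g g∉v))) nil)

  hyperedge-adjacent : ∀ {E} → IsHyperedge E → ∀ {x y} → E x → E y → Adjacent x y
  hyperedge-adjacent (E-clique , _) = clique-adjacent E-clique

  path-length≥1 : ∀ {u v : Sub m} {k} → u ≢ v → Path u v k → 1 ≤ k
  path-length≥1 u≢v nil = ⊥-elim (u≢v refl)
  path-length≥1 u≢v (cons _ _ _ _ _) = s≤s z≤n

  path-length≥2 : ∀ {u v : Sub m} {k} → ¬ Adjacent u v → Path u v k → 2 ≤ k
  path-length≥2 u≁v nil = ⊥-elim (u≁v (inj₁ refl))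
  path-length≥2 u≁v (cons _ E u∈ v∈ nil) = ⊥-elim (u≁v (hyperedge-adjacent E u∈ v∈))
  path-length≥2 u≁v (cons _ _ _ _ (cons _ _ _ _ _)) = s≤s (s≤s z≤n)

  path-length≥3 : ∀ {u v : Sub m} {k} → ¬ Adjacent u v → (∀ w → IsVertex w → Adjacent u w → ¬ Adjacent w v)
                → Path u v k → 3 ≤ k
  path-length≥3 u≁v _ nil = ⊥-elim (u≁v (inj₁ refl))
  path-length≥3 u≁v _ (cons _ E u∈ v∈ nil) = ⊥-elim (u≁v (hyperedge-adjacent E u∈ v∈))
  path-length≥3 _ no-middle (cons {w = w} _ E u∈ w∈ (cons _ E′ w∈′ v∈ nil)) =
    ⊥-elim (no-middle w (proj₁ (proj₁ E) w w∈) (hyperedge-adjacent E u∈ w∈) (hyperedge-adjacent E′ w∈′ v∈))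
  path-length≥3 _ _ (cons _ _ _ _ (cons _ _ _ _ (cons _ _ _ _ _))) = s≤s (s≤s (s≤s z≤n))

  ⁅e,ref⁆-adjacent : ∀ j k → Adjacent ⁅e, ref j ⁆ ⁅e, ref k ⁆
  ⁅e,ref⁆-adjacent j k with k ≟ᶠ j
  ... | yes refl = inj₁ refl
  ... | no k≢j = inj₂ (⁅e,g⁆-trivInt (ref k) (ref∉⁅e,ref⁆ k≢j))

  distance≤3 : ∀ {u v : Sub m} → InS u → InS v → Path u v 3
  distance≤3 u∈S v∈S with misses-reflection u∈S | misses-reflection v∈S
  ... | j , j∉u | k , k∉v =
    step u∈S j∈S (inj₂ (⁅e,g⁆-trivInt (ref j) j∉u))
      (step j∈S k∈S (⁅e,ref⁆-adjacent j k)
        (step k∈S v∈S (inj₂ (TrivInt-sym (⁅e,g⁆-trivInt (ref k) k∉v))) nil))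
    where
      j∈S = ⁅e,ref⁆-InS u∈S j∉u
      k∈S = ⁅e,ref⁆-InS v∈S k∉v

Diameter≤ : ℕ → ℕ → Set₁
Diameter≤ m d = ∀ (u v : Sub m) → IsVertex u → IsVertex v → Σ ℕ λ k → k ≤ d × Path u v k

Diameter≥ : ℕ → ℕ → Set₁
Diameter≥ m d = Σ (Sub m) λ u → Σ (Sub m) λ v → IsVertex u × IsVertex v × (∀ k → Path u v k → d ≤ k)

diameter≤3 : ∀ {m} → Diameter≤ m 3
diameter≤3 u v Vu Vv = 3 , ≤-refl , distance≤3 (proj₁ Vu) (proj₁ Vv)

-- Generators of the rotation subgroup; n prime

module _ {m : ℕ} where

  one two : Fin (2 + m)
  one = suc zero
  two = one ∙ one

  rot-one⇒rotations : ∀ {H : Sub (suc m)} → IsSubgroup H → rot one ∈D H → ∀ t → rot t ∈D H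
  rot-one⇒rotations {H} H≤ one∈ t = subst (λ i → rot i ∈D H)
    (trans (cong (_mod (2 + m)) (*-identityʳ (toℕ t))) (mod-toℕ t)) (rot-multiple-closed H≤ 1 one∈ (toℕ t))

  proper⇒rot-one∉ : ∀ {H : Sub (suc m)} {p} → InS H → ref p ∈D H → ¬ rot one ∈D H
  proper⇒rot-one∉ (H≤ , _ , x , x∉) p∈ one∈ = x∉ (rotations⇒everything H≤ (rot-one⇒rotations H≤ one∈) p∈ x)

  prime⇒rot-one∈ : Prime (2 + m) → ∀ {H : Sub (suc m)} → IsSubgroup H → ∀ {i} → rot i ∈D H → i ≢ ε
                 → rot one ∈D H
  prime⇒rot-one∈ _ _ {zero} _ i≢ε = ⊥-elim (i≢ε refl)
  prime⇒rot-one∈ p {H} H≤ {i@(suc _)} i∈ _ = from-bézout (coprime-Bézout (prime⇒coprime p (toℕ<n i)))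
    where
      yi∈ : ∀ y → rot ((y * toℕ i) mod (2 + m)) ∈D H
      yi∈ = rot-multiple-closed H≤ (toℕ i) (subst (λ t → rot t ∈D H) (sym (mod-toℕ i)) i∈)

      from-bézout : Bézout.Identity 1 (2 + m) (toℕ i) → rot one ∈D H
      from-bézout (Bézout.-+ x y 1+xn≡yi) = subst (λ t → rot t ∈D H) yi≡one (yi∈ y)
        where
          yi≡one : (y * toℕ i) mod (2 + m) ≡ one
          yi≡one = mod-cong {y * toℕ i} {1} (2 + m) (begin
            (y * toℕ i) % (2 + m)       ≡⟨ cong (_% (2 + m)) 1+xn≡yi ⟨
            (1 + x * (2 + m)) % (2 + m) ≡⟨ [m+kn]%n≡m%n 1 x (2 + m) ⟩
            1 % (2 + m)                 ∎)
      from-bézout (Bézout.+- x y 1+yi≡xn) = subst (λ t → rot t ∈D H) (sym one≡-yi) (rot⁻¹-closed H≤ (yi∈ y))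
        where
          one≡-yi : one ≡ ((y * toℕ i) mod (2 + m)) ⁻¹
          one≡-yi = inverseˡ-unique one ((y * toℕ i) mod (2 + m)) (begin
            one ∙ ((y * toℕ i) mod (2 + m)) ≡⟨ mod-+-homo 1 (y * toℕ i) ⟨
            (1 + y * toℕ i) mod (2 + m)     ≡⟨ cong (_mod (2 + m)) 1+yi≡xn ⟩
            (x * (2 + m)) mod (2 + m)       ≡⟨ mod≡zero (x * (2 + m)) (m*n%n≡0 x (2 + m)) ⟩
            ε                               ∎)

  -- For n prime, a nontrivial proper subgroup is either the rotation subgroup or {e, a^i b}.
  module _ (p : Prime (2 + m)) where

    rot∈proper⇒≡ε : ∀ {H : Sub (suc m)} {q t} → InS H → ref q ∈D H → rot t ∈D H → t ≡ ε
    rot∈proper⇒≡ε H∈S q∈ t∈ with _ ≟ᶠ ε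
    ... | yes t≡ε = t≡ε
    ... | no t≢ε = ⊥-elim (proper⇒rot-one∉ H∈S q∈ (prime⇒rot-one∈ p (proj₁ H∈S) t∈ t≢ε))

    shared-nontrivial⇒⊆ : ∀ {H K : Sub (suc m)} → InS H → IsSubgroup K → ∀ x → x ∈D H → x ∈D K → x ≢ e
                        → ∀ y → y ∈D H → y ∈D K
    shared-nontrivial⇒⊆ H∈S K≤ (rot i) _ i∈K x≢e (rot t) _ =
      rot-one⇒rotations K≤ (prime⇒rot-one∈ p K≤ i∈K (x≢e ∘ cong rot)) t
    shared-nontrivial⇒⊆ H∈S K≤ (rot i) i∈H _ x≢e (ref q) q∈H =
      ⊥-elim (proper⇒rot-one∉ H∈S q∈H (prime⇒rot-one∈ p (proj₁ H∈S) i∈H (x≢e ∘ cong rot)))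
    shared-nontrivial⇒⊆ {K = K} H∈S K≤ (ref i) i∈H _ _ (rot t) t∈H =
      subst (λ s → rot s ∈D K) (sym (rot∈proper⇒≡ε H∈S i∈H t∈H)) (e∈ K≤)
    shared-nontrivial⇒⊆ {K = K} H∈S K≤ (ref i) i∈H i∈K _ (ref q) q∈H =
      subst (λ s → ref s ∈D K) (sym q≡i) i∈K
      where q≡i = x∙y⁻¹≈ε⇒x≈y q i (rot∈proper⇒≡ε H∈S i∈H (ref-ref-closed (proj₁ H∈S) q∈H i∈H))

    prime⇒trivInt : ∀ {H K : Sub (suc m)} → InS H → InS K → H ≢ K → TrivInt H K
    prime⇒trivInt H∈S K∈S H≢K x x∈H x∈K with x ≟Elem e
    ... | yes x≡e = x≡e
    ... | no x≢e = ⊥-elim (H≢K (Sub-ext (shared-nontrivial⇒⊆ H∈S (proj₁ K∈S) x x∈H x∈K x≢e)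
                                         (shared-nontrivial⇒⊆ K∈S (proj₁ H∈S) x x∈K x∈H x≢e)))

    prime⇒diameter≡1 : Diameter (suc m) 1
    prime⇒diameter≡1 = upper , ⁅e, ref ε ⁆ , ⁅e, ref one ⁆ , V₀ , V₁ , λ _ → path-length≥1 b≢ab
      where
        upper : Diameter≤ (suc m) 1
        upper u v Vu Vv with u ≟Sub v
        ... | yes refl = 0 , z≤n , nil
        ... | no u≢v = 1 , ≤-refl , step u∈S v∈S (inj₂ (prime⇒trivInt u∈S v∈S u≢v)) nil
          where
            u∈S = proj₁ Vu
            v∈S = proj₁ Vv
        V₀ = InS⇒IsVertex (⁅e,g⁆-InS (ref ε) (ref one) (ref-involution ε) (λ ()) (λ ()) (λ ()))
        V₁ = InS⇒IsVertex (⁅e,g⁆-InS (ref one) (ref ε) (ref-involution one) (λ ()) (λ ()) (λ ()))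
        b≢ab : ⁅e, ref ε ⁆ ≢ ⁅e, ref one ⁆
        b≢ab eq = ref∉⁅e,ref⁆ {i = ε} {j = one} (λ ()) (subst (ref ε ∈D_) eq (∈⁅e,g⁆⁺ (ref ε) (inj₂ refl)))

-- Upper bound 2 when 4 ∤ n

  record Covers (u v : Sub (suc m)) : Set where
    constructor covering
    field cover : ∀ j → ref j ∈D u ⊎ ref j ∈D v
  open Covers

  covers-sym : ∀ {u v} → Covers u v → Covers v u
  covers-sym cov = covering λ j → [ inj₂ , inj₁ ]′ (cover cov j)

  uncovered-or-covers : (u v : Sub (suc m)) → (∃ λ j → ¬ ref j ∈D u × ¬ ref j ∈D v) ⊎ Covers u v
  uncovered-or-covers u v with any? (λ j → ¬? (ref j ∈D? u) ×-dec ¬? (ref j ∈D? v))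
  ... | yes uncovered = inj₁ uncovered
  ... | no none = inj₂ (covering covered)
    where
      covered : ∀ j → ref j ∈D u ⊎ ref j ∈D v
      covered j with ref j ∈D? u | ref j ∈D? v
      ... | yes j∈u | _ = inj₁ j∈u
      ... | no _ | yes j∈v = inj₂ j∈v
      ... | no j∉u | no j∉v = ⊥-elim (none (j , j∉u , j∉v))

  covers-∉ : ∀ {u v j} → Covers u v → ¬ ref j ∈D v → ref j ∈D u
  covers-∉ {j = j} cov j∉v = [ id , (λ j∈v → ⊥-elim (j∉v j∈v)) ]′ (cover cov j)

  covers⇒reflection : ∀ {u v} → InS v → Covers u v → ∃ λ p → ref p ∈D u
  covers⇒reflection v∈S cov with misses-reflection v∈S
  ... | j , j∉v = j , covers-∉ cov j∉v

  -- The reflections a^{±1} · a^q b are not in v (else a ∈ v), so they lie in u; their quotient is a².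
  covers⇒rot-two∈ : ∀ {u v} → InS u → InS v → Covers u v → rot two ∈D u
  covers⇒rot-two∈ {u} {v} u∈S v∈S cov with covers⇒reflection u∈S (covers-sym cov)
  ... | q , q∈v =
    subst (λ t → rot t ∈D u) shift (ref-ref-closed (proj₁ u∈S) (covers-∉ cov one∙q∉v) (covers-∉ cov one⁻¹∙q∉v))
    where
      one∉v : ¬ rot one ∈D v
      one∉v = proper⇒rot-one∉ v∈S q∈v
      one∙q∉v : ¬ ref (one ∙ q) ∈D v
      one∙q∉v r = one∉v (subst (λ t → rot t ∈D v) (//-rightDividesʳ q one) (ref-ref-closed (proj₁ v∈S) r q∈v))
      one⁻¹∙q∉v : ¬ ref (one ⁻¹ ∙ q) ∈D v
      one⁻¹∙q∉v r = one∉v (subst (λ t → rot t ∈D v) (⁻¹-involutive one) (rot⁻¹-closed (proj₁ v∈S) one⁻¹∈v))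
        where
          one⁻¹∈v : rot (one ⁻¹) ∈D v
          one⁻¹∈v = subst (λ t → rot t ∈D v) (//-rightDividesʳ q (one ⁻¹)) (ref-ref-closed (proj₁ v∈S) r q∈v)
      shift : (one ∙ q) - (one ⁻¹ ∙ q) ≡ two
      shift = trans ([x∙z]-[y∙z]≡x-y one (one ⁻¹) q) (cong (one ∙_) (⁻¹-involutive one))

  covers⇒rot-even∈ : ∀ {u v} → InS u → InS v → Covers u v → ∀ k → rot ((k * 2) mod (2 + m)) ∈D u
  covers⇒rot-even∈ u∈S v∈S cov = rot-multiple-closed (proj₁ u∈S) 2 (covers⇒rot-two∈ u∈S v∈S cov)

  odd⇒¬covers : ∀ {u v} k → 2 + m ≡ 1 + k * 2 → InS u → InS v → ¬ Covers u v
  odd⇒¬covers {u} k n≡1+2k u∈S v∈S cov with covers⇒reflection v∈S cov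
  ... | p , p∈u = proper⇒rot-one∉ u∈S p∈u
        (subst (λ t → rot t ∈D u) (⁻¹-involutive one) (rot⁻¹-closed (proj₁ u∈S) one⁻¹∈u))
    where
      one⁻¹∈u : rot (one ⁻¹) ∈D u
      one⁻¹∈u = subst (λ a → rot (a mod (2 + m)) ∈D u) (sym (suc-injective n≡1+2k))
                      (covers⇒rot-even∈ u∈S v∈S cov k)

  module _ (k : ℕ) (n≡2h : 2 + m ≡ (1 + k * 2) * 2) where
    private
      h = 1 + k * 2

    half-turn : Fin (2 + m)
    half-turn = h mod (2 + m)

    toℕ-half-turn : toℕ half-turn ≡ h
    toℕ-half-turn = trans (toℕ-mod h (2 + m)) (m<n⇒m%n≡m (subst (h <_) (sym n≡2h) (m<m*n h 2 (s≤s (s≤s z≤n)))))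

    half-turn≢ε : half-turn ≢ ε
    half-turn≢ε eq with trans (sym toℕ-half-turn) (cong toℕ eq)
    ... | ()

    half-turn-involution : rot half-turn · rot half-turn ≡ e
    half-turn-involution = cong rot (begin
      half-turn ∙ half-turn ≡⟨ mod-+-homo h h ⟨
      (h + h) mod (2 + m)   ≡⟨ cong (_mod (2 + m)) h+h≡n ⟩
      (2 + m) mod (2 + m)   ≡⟨ mod≡zero (2 + m) (n%n≡0 (2 + m)) ⟩
      ε                     ∎)
      where h+h≡n = trans (cong (h +_) (sym (+-identityʳ h))) (trans (*-comm 2 h) (sym n≡2h))

    half-turn-InS : InS ⁅e, rot half-turn ⁆
    half-turn-InS =
      ⁅e,g⁆-InS (rot half-turn) (ref ε) half-turn-involution (half-turn≢ε ∘ rot-injective) (λ ()) (λ ())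

    covers⇒half-turn∉ : ∀ {u v} → InS u → InS v → Covers u v → ¬ rot half-turn ∈D u
    covers⇒half-turn∉ {u} u∈S v∈S cov h∈u with covers⇒reflection v∈S cov
    ... | p , p∈u = proper⇒rot-one∉ u∈S p∈u
          (subst (λ t → rot t ∈D u) h-2k≡one (rot-closed (proj₁ u∈S) h∈u (rot⁻¹-closed (proj₁ u∈S) 2k∈u)))
      where
        2k∈u : rot ((k * 2) mod (2 + m)) ∈D u
        2k∈u = covers⇒rot-even∈ u∈S v∈S cov k
        h-2k≡one : half-turn - (k * 2) mod (2 + m) ≡ one
        h-2k≡one = trans (cong (λ t → t - (k * 2) mod (2 + m)) (mod-+-homo 1 (k * 2)))
                         (//-rightDividesʳ ((k * 2) mod (2 + m)) one)

  distance≤2 : ∀ {u v} → ¬ 4 ∣ 2 + m → InS u → InS v → Path u v 2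
  distance≤2 {u} {v} 4∤n u∈S v∈S with uncovered-or-covers u v
  ... | inj₁ (j , j∉u , j∉v) = path-via (ref j) u∈S v∈S (⁅e,ref⁆-InS u∈S j∉u) j∉u j∉v
  ... | inj₂ cov with parity (2 + m)
  ...   | odd k n≡1+2k = ⊥-elim (odd⇒¬covers k n≡1+2k u∈S v∈S cov)
  ...   | even h n≡2h with parity h
  ...     | even k refl = ⊥-elim (4∤n (divides k (trans n≡2h (*-assoc k 2 2))))
  ...     | odd k refl = path-via (rot (half-turn k n≡2h)) u∈S v∈S (half-turn-InS k n≡2h)
                             (half-turn∉ u∈S v∈S cov) (half-turn∉ v∈S u∈S (covers-sym cov))
    where half-turn∉ = covers⇒half-turn∉ k n≡2h

-- Lower bounds from ⟨a^d, b⟩ and ⟨a^d, ab⟩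

-- For d ∣ n, reduction mod d is a homomorphism D_n → D_d, and ⟨a^d, b⟩, ⟨a^d, ab⟩ are the preimages
-- of {e, b} and {e, ab}.
module Reduction {m d : ℕ} (d∣n : suc d ∣ suc m) where

  reduce : Fin (suc m) → Fin (suc d)
  reduce i = toℕ i mod suc d

  reduce-∙-homo : ∀ i j → reduce (i ∙ j) ≡ reduce i ∙ reduce j
  reduce-∙-homo i j = begin
    toℕ (a mod suc m) mod suc d ≡⟨ mod-cong {toℕ (a mod suc m)} {a} (suc d) a%n%d≡a%d ⟩
    a mod suc d                  ≡⟨ mod-+-homo (toℕ i) (toℕ j) ⟩
    reduce i ∙ reduce j          ∎
    where
      a = toℕ i + toℕ j
      a%n%d≡a%d = trans (cong (_% suc d) (toℕ-mod a (suc m))) (m∣n⇒o%n%m≡o%m (suc d) (suc m) a d∣n)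

  reduce-⁻¹-homo : ∀ i → reduce (i ⁻¹) ≡ reduce i ⁻¹
  reduce-⁻¹-homo i =
    inverseˡ-unique (reduce (i ⁻¹)) (reduce i) (trans (sym (reduce-∙-homo (i ⁻¹) i)) (cong reduce (inverseˡ i)))

  reduce-∙⁻¹-homo : ∀ i j → reduce (i ∙ j ⁻¹) ≡ reduce i ∙ reduce j ⁻¹
  reduce-∙⁻¹-homo i j = trans (reduce-∙-homo i (j ⁻¹)) (cong (reduce i ∙_) (reduce-⁻¹-homo j))

  π : Elem m → Elem d
  π (rot i) = rot (reduce i)
  π (ref i) = ref (reduce i)

  π-·-homo : ∀ x y → π (x · y) ≡ π x · π y
  π-·-homo (rot i) (rot j) = cong rot (reduce-∙-homo i j)
  π-·-homo (rot i) (ref j) = cong ref (reduce-∙-homo i j)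
  π-·-homo (ref i) (rot j) = cong ref (reduce-∙⁻¹-homo i j)
  π-·-homo (ref i) (ref j) = cong rot (reduce-∙⁻¹-homo i j)

  π-inv-homo : ∀ x → π (inv x) ≡ inv (π x)
  π-inv-homo (rot i) = cong rot (reduce-⁻¹-homo i)
  π-inv-homo (ref i) = refl

  preimage : Sub d → Sub m
  preimage (mkSub r f) = mkSub (preimageₛ reduce r) (preimageₛ reduce f)

  ∈-preimage⁺ : ∀ K x → π x ∈D K → x ∈D preimage K
  ∈-preimage⁺ _ (rot i) = ∈-preimageₛ⁺ {f = reduce}
  ∈-preimage⁺ _ (ref i) = ∈-preimageₛ⁺ {f = reduce}

  ∈-preimage⁻ : ∀ K x → x ∈D preimage K → π x ∈D K
  ∈-preimage⁻ _ (rot i) = ∈-preimageₛ⁻ {f = reduce}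
  ∈-preimage⁻ _ (ref i) = ∈-preimageₛ⁻ {f = reduce}

  preimage-isSubgroup : ∀ K → IsSubgroup K → IsSubgroup (preimage K)
  preimage-isSubgroup K (e∈K , ·-closed , inv-closed) =
      ∈-preimage⁺ K e e∈K
    , (λ x y x∈ y∈ → ∈-preimage⁺ K (x · y) (subst (_∈D K) (sym (π-·-homo x y))
         (·-closed (π x) (π y) (∈-preimage⁻ K x x∈) (∈-preimage⁻ K y y∈))))
    , (λ x x∈ → ∈-preimage⁺ K (inv x) (subst (_∈D K) (sym (π-inv-homo x))
         (inv-closed (π x) (∈-preimage⁻ K x x∈))))

module _ {m d : ℕ} (d∣n : 2 + d ∣ 2 + m) where
  open Reduction d∣n

  ⟨aᵈ,b⟩ ⟨aᵈ,ab⟩ : Sub (suc m)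
  ⟨aᵈ,b⟩ = preimage ⁅e, ref ε ⁆
  ⟨aᵈ,ab⟩ = preimage ⁅e, ref one ⁆

  rot∈⟨aᵈ,b⟩ : ∀ {i} → reduce i ≡ ε → rot i ∈D ⟨aᵈ,b⟩
  rot∈⟨aᵈ,b⟩ {i} eq = ∈-preimage⁺ ⁅e, ref ε ⁆ (rot i) (∈⁅e,g⁆⁺ (ref ε) (inj₁ (cong rot eq)))

  rot∈⟨aᵈ,ab⟩ : ∀ {i} → reduce i ≡ ε → rot i ∈D ⟨aᵈ,ab⟩
  rot∈⟨aᵈ,ab⟩ {i} eq = ∈-preimage⁺ ⁅e, ref one ⁆ (rot i) (∈⁅e,g⁆⁺ (ref one) (inj₁ (cong rot eq)))

  ref∈⟨aᵈ,b⟩ : ∀ {i} → reduce i ≡ ε → ref i ∈D ⟨aᵈ,b⟩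
  ref∈⟨aᵈ,b⟩ {i} eq = ∈-preimage⁺ ⁅e, ref ε ⁆ (ref i) (∈⁅e,g⁆⁺ (ref ε) (inj₂ (cong ref eq)))

  ref∈⟨aᵈ,ab⟩ : ∀ {i} → reduce i ≡ one → ref i ∈D ⟨aᵈ,ab⟩
  ref∈⟨aᵈ,ab⟩ {i} eq = ∈-preimage⁺ ⁅e, ref one ⁆ (ref i) (∈⁅e,g⁆⁺ (ref one) (inj₂ (cong ref eq)))

  one∉⟨aᵈ,b⟩ : ¬ ref one ∈D ⟨aᵈ,b⟩
  one∉⟨aᵈ,b⟩ = ref∉⁅e,ref⁆ {i = one} {j = ε} (λ ()) ∘ ∈-preimage⁻ ⁅e, ref ε ⁆ (ref one)

  ε∉⟨aᵈ,ab⟩ : ¬ ref ε ∈D ⟨aᵈ,ab⟩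
  ε∉⟨aᵈ,ab⟩ = ref∉⁅e,ref⁆ {i = ε} {j = one} (λ ()) ∘ ∈-preimage⁻ ⁅e, ref one ⁆ (ref ε)

  ⟨aᵈ,b⟩-InS : InS ⟨aᵈ,b⟩
  ⟨aᵈ,b⟩-InS = preimage-isSubgroup ⁅e, ref ε ⁆ (⁅e,g⁆-isSubgroup (ref ε) (ref-involution ε))
             , (ref ε , ref∈⟨aᵈ,b⟩ refl , λ ())
             , (ref one , one∉⟨aᵈ,b⟩)

  ⟨aᵈ,ab⟩-InS : InS ⟨aᵈ,ab⟩
  ⟨aᵈ,ab⟩-InS = preimage-isSubgroup ⁅e, ref one ⁆ (⁅e,g⁆-isSubgroup (ref one) (ref-involution one))
              , (ref one , ref∈⟨aᵈ,ab⟩ refl , λ ())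
              , (ref ε , ε∉⟨aᵈ,ab⟩)

  module _ (d<n : 2 + d < 2 + m) where
    private
      aᵈ : Fin (2 + m)
      aᵈ = (2 + d) mod (2 + m)

      toℕ-aᵈ : toℕ aᵈ ≡ 2 + d
      toℕ-aᵈ = trans (toℕ-mod (2 + d) (2 + m)) (m<n⇒m%n≡m d<n)

      aᵈ≢ε : aᵈ ≢ ε
      aᵈ≢ε eq with trans (sym toℕ-aᵈ) (cong toℕ eq)
      ... | ()

      reduce-aᵈ : reduce aᵈ ≡ ε
      reduce-aᵈ = trans (cong (_mod (2 + d)) toℕ-aᵈ) (mod≡zero (2 + d) (n%n≡0 (2 + d)))

    ⟨aᵈ,b⟩≁⟨aᵈ,ab⟩ : ¬ Adjacent ⟨aᵈ,b⟩ ⟨aᵈ,ab⟩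
    ⟨aᵈ,b⟩≁⟨aᵈ,ab⟩ (inj₁ eq) = ε∉⟨aᵈ,ab⟩ (subst (ref ε ∈D_) eq (ref∈⟨aᵈ,b⟩ refl))
    ⟨aᵈ,b⟩≁⟨aᵈ,ab⟩ (inj₂ trivial) =
      aᵈ≢ε (rot-injective (trivial (rot aᵈ) (rot∈⟨aᵈ,b⟩ reduce-aᵈ) (rot∈⟨aᵈ,ab⟩ reduce-aᵈ)))

diameter≥2 : ∀ {m d} → 2 + d ∣ 2 + m → 2 + d < 2 + m → Diameter≥ (suc m) 2
diameter≥2 d∣n d<n =
    ⟨aᵈ,b⟩ d∣n , ⟨aᵈ,ab⟩ d∣n , InS⇒IsVertex (⟨aᵈ,b⟩-InS d∣n) , InS⇒IsVertex (⟨aᵈ,ab⟩-InS d∣n)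
  , λ _ → path-length≥2 (⟨aᵈ,b⟩≁⟨aᵈ,ab⟩ d∣n d<n)

composite⇒diameter≥2 : ∀ {m} → Composite (2 + m) → Diameter≥ (suc m) 2
composite⇒diameter≥2 (composite {d} d<n d∣n) with nonTrivial⇒n>1 d
... | s≤s (s≤s _) = diameter≥2 d∣n d<n

fourfold⇒2<n : ∀ m k → 2 + m ≡ k * 4 → 2 < 2 + m
fourfold⇒2<n zero zero ()
fourfold⇒2<n zero (suc k) ()
fourfold⇒2<n (suc m) _ _ = s≤s (s≤s (s≤s z≤n))

module _ {m : ℕ} (k : ℕ) (n≡4k : 2 + m ≡ k * 4) where
  private
    2∣n : 2 ∣ 2 + m
    2∣n = divides (k * 2) (trans n≡4k (sym (*-assoc k 2 2)))
  open Reduction 2∣n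

  involution⇒even : ∀ {i} → i ∙ i ≡ ε → reduce i ≡ ε
  involution⇒even {i} ii≡ε with i ≟ᶠ ε
  ... | yes refl = refl
  ... | no i≢ε = trans (cong (_mod 2) i≡2k) (mod≡zero (k * 2) (m*n%n≡0 k 2))
    where
      i≡2k : toℕ i ≡ k * 2
      i≡2k = *-cancelˡ-≡ (toℕ i) (k * 2) 2 (begin
        2 * toℕ i     ≡⟨ cong (toℕ i +_) (+-identityʳ (toℕ i)) ⟩
        toℕ i + toℕ i ≡⟨ involution-index ii≡ε i≢ε ⟩
        2 + m         ≡⟨ n≡4k ⟩
        k * 4         ≡⟨ *-distribˡ-+ k 2 2 ⟩
        k * 2 + k * 2 ≡⟨ cong (k * 2 +_) (+-identityʳ (k * 2)) ⟨
        2 * (k * 2)   ∎)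

  no-common-neighbour : ∀ w → IsVertex w → Adjacent (⟨aᵈ,b⟩ 2∣n) w → ¬ Adjacent w (⟨aᵈ,ab⟩ 2∣n)
  no-common-neighbour w _ (inj₁ refl) w~v = ⟨aᵈ,b⟩≁⟨aᵈ,ab⟩ 2∣n (fourfold⇒2<n m k n≡4k) w~v
  no-common-neighbour w _ (inj₂ u∩w) (inj₁ refl) = ⟨aᵈ,b⟩≁⟨aᵈ,ab⟩ 2∣n (fourfold⇒2<n m k n≡4k) (inj₂ u∩w)
  no-common-neighbour w ((w≤ , (x , x∈ , x≢e) , _) , _) (inj₂ u∩w) (inj₂ w∩v) = x≢e (trivial x x∈)
    where
      trivial : ∀ x → x ∈D w → x ≡ e
      trivial (ref i) i∈ with reduce i in eq
      ... | zero = u∩w (ref i) (ref∈⟨aᵈ,b⟩ 2∣n eq) i∈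
      ... | suc zero = w∩v (ref i) i∈ (ref∈⟨aᵈ,ab⟩ 2∣n eq)
      trivial (rot i) i∈ = u∩w (rot i) (rot∈⟨aᵈ,b⟩ 2∣n (involution⇒even {i} (rot-injective ii≡e))) i∈
        where
          ii≡e : rot (i ∙ i) ≡ e
          ii≡e = u∩w (rot (i ∙ i)) (rot∈⟨aᵈ,b⟩ 2∣n (trans (reduce-∙-homo i i) (ℤ/2-double (reduce i))))
                     (rot-closed w≤ i∈ i∈)

  fourfold⇒diameter≥3 : Diameter≥ (suc m) 3
  fourfold⇒diameter≥3 =
      ⟨aᵈ,b⟩ 2∣n , ⟨aᵈ,ab⟩ 2∣n , InS⇒IsVertex (⟨aᵈ,b⟩-InS 2∣n) , InS⇒IsVertex (⟨aᵈ,ab⟩-InS 2∣n)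
    , λ _ → path-length≥3 (⟨aᵈ,b⟩≁⟨aᵈ,ab⟩ 2∣n (fourfold⇒2<n m k n≡4k)) no-common-neighbour

mainTheorem3 : (m : ℕ) → 1 ≤ m →
    (Prime (suc m) → Diameter m 1)
    × ((Σ ℕ λ k → 1 ≤ k × suc m ≡ 4 * k) → Diameter m 3)
    × (¬ Prime (suc m) → ¬ (Σ ℕ λ k → 1 ≤ k × suc m ≡ 4 * k) → Diameter m 2)
mainTheorem3 zero ()
mainTheorem3 (suc m) _ = prime⇒diameter≡1 , fourfold , otherwise
  where
    fourfold : (Σ ℕ λ k → 1 ≤ k × 2 + m ≡ 4 * k) → Diameter (suc m) 3
    fourfold (k , _ , n≡4k) = diameter≤3 , fourfold⇒diameter≥3 k (trans n≡4k (*-comm 4 k))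

    otherwise : ¬ Prime (2 + m) → ¬ (Σ ℕ λ k → 1 ≤ k × 2 + m ≡ 4 * k) → Diameter (suc m) 2
    otherwise ¬prime ¬fourfold =
        (λ u v Vu Vv → 2 , ≤-refl , distance≤2 4∤n (proj₁ Vu) (proj₁ Vv))
      , composite⇒diameter≥2 (¬prime⇒composite ¬prime)
      where
        4∤n : ¬ 4 ∣ 2 + m
        4∤n (divides (suc k) n≡4k) = ¬fourfold (suc k , s≤s z≤n , trans n≡4k (*-comm (suc k) 4))
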